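{- For every constant $\epsilon > 0$ there exists a constant $C > 0$ such that for arbitrarily large $m$ there is an instance $\mathcal{I}$ of Min Label $s$-$t$ Cut whose graph has $m$ edges and which satisfies \[ \frac{OPT(\mathcal{I})}{OPT_f(\mathrm{LP2}(\mathcal{I}))} \;\ge\; C\, m^{1/3-\epsilon}. \] In other words, the integrality gap of the linear programming relaxation LP2 for Min Label $s$-$t$ Cut is $\Omega(m^{1/3-\epsilon})$ for every constant $\epsilon>0$.
   Context: Min Label $s$-$t$ Cut: an instance consists of a (directed or undirected) graph $G=(V,E)$, vertices $s,t\in V$, a label set $L=\{\ell_1,\dots,\ell_q\}$, and a labeling assigning each edge $e$ a label $\ell(e)\in L$. A set $L'\subseteq L$ is a label $s$-$t$ cut if removing all edges whose labels lie in $L'$ disconnects $t$ from $s$. $OPT(\mathcal{I})$ is the minimum size of a label $s$-$t$ cut. $m=|E|$. For a set $P$ of edges, $L(P)$ is the set of labels occurring on edges of $P$. Let $\mathcal{P}_{st}$ be the set of all simple $s$-$t$ paths, each viewed as its edge set. The linear program LP2 is: minimize $\sum_{\ell\in L} x_\ell$ subject to $\sum_{\ell\in L(P)} x_\ell \ge 1$ for all $P\in\mathcal{P}_{st}$, and $x_\ell\ge 0$ for all $\ell\in L$. $OPT_f(\mathrm{LP2}(\mathcal{I}))$ denotes its optimal value on instance $\mathcal{I}$. The integrality gap of LP2 is $\sup_{\mathcal{I}} OPT(\mathcal{I})/OPT_f(\mathrm{LP2}(\mathcal{I}))$.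
   Formalization: The constant ε ranges over the positive rationals, and LP2 is taken over ℚ, so its optimal value is the minimum over rational feasible solutions. -}

module Defs where

open import Data.Nat as ℕ using (ℕ; zero; suc)
open import Data.Fin using (Fin)
open import Data.Product using (Σ; _×_; _,_)
open import Data.Sum using (_⊎_)
open import Data.Bool using (Bool; true; false; if_then_else_)
open import Data.List using (List; []; _∷_; map)
open import Data.List.Relation.Unary.Unique.Propositional using (Unique)
open import Data.List.Relation.Unary.Any using (Any)
open import Relation.Binary.PropositionalEquality using (_≡_)
open import Relation.Nullary using (¬_; does)
open import Data.Fin.Subset using (Subset; _∈_; _∉_; ∣_∣)
open import Data.Rational as ℚ using (ℚ; 0ℚ; 1ℚ)
open import Data.Fin using () renaming (_≟_ to _≟ᶠ_)
open import Data.List.Relation.Unary.Any using (any?)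

-- Instances of Min Label s-t Cut (undirected multigraph)
-- vertices Fin n, edges Fin m (edge e joins endpoints e), labels Fin q.

record Instance (m : ℕ) : Set where
  field
    n q     : ℕ
    s t     : Fin n
    ends    : Fin m → Fin n × Fin n
    label   : Fin m → Fin q

module _ {m : ℕ} (I : Instance m) where
  open Instance I

  Adj : Fin m → Fin n → Fin n → Set
  Adj e u w = (ends e ≡ (u , w)) ⊎ (ends e ≡ (w , u))

  data Reach (L' : Subset q) : Fin n → Set where
    here : Reach L' s
    step : ∀ {u w} (e : Fin m) → label e ∉ L' → Adj e u w → Reach L' u → Reach L' w

  IsLabelCut : Subset q → Set
  IsLabelCut L' = ¬ Reach L' t

  IsOPT : ℕ → Set
  IsOPT k = Σ (Subset q) (λ L' → IsLabelCut L' × ∣ L' ∣ ≡ k)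
          × (∀ L' → IsLabelCut L' → k ℕ.≤ ∣ L' ∣)

  data Walk : Fin n → Fin n → Set where
    [] : ∀ {u} → Walk u u
    _∷⟨_⟩_ : ∀ {u w v} (e : Fin m) → Adj e u w → Walk w v → Walk u v

  vertices : ∀ {u v} → Walk u v → List (Fin n)
  vertices {u} [] = u ∷ []
  vertices {u} (e ∷⟨ _ ⟩ p) = u ∷ vertices p

  edges : ∀ {u v} → Walk u v → List (Fin m)
  edges [] = []
  edges (e ∷⟨ _ ⟩ p) = e ∷ edges p

  SimplePath : Walk s t → Set
  SimplePath p = Unique (vertices p)

  occurs : ∀ {u v} → Walk u v → Fin q → Bool
  occurs p ℓ = does (any? (λ e → label e ≟ᶠ ℓ) (edges p))

  sumℚ : ∀ {k} → (Fin k → ℚ) → ℚ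
  sumℚ {zero} f = 0ℚ
  sumℚ {suc k} f = f Fin.zero ℚ.+ sumℚ (λ i → f (Fin.suc i))

  lpValue : (Fin q → ℚ) → ℚ
  lpValue x = sumℚ x

  LP2Feasible : (Fin q → ℚ) → Set
  LP2Feasible x = (∀ ℓ → 0ℚ ℚ.≤ x ℓ)
                × (∀ (p : Walk s t) → SimplePath p →
                     1ℚ ℚ.≤ sumℚ (λ ℓ → if occurs p ℓ then x ℓ else 0ℚ))

  -- x is an optimal solution of LP2, so OPT_f(LP2(I)) = lpValue x
  LP2Optimal : (Fin q → ℚ) → Set
  LP2Optimal x = LP2Feasible x × (∀ y → LP2Feasible y → lpValue x ℚ.≤ lpValue y)

_^ℚ_ : ℚ → ℕ → ℚ
x ^ℚ zero = 1ℚ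
x ^ℚ suc k = x ℚ.* (x ^ℚ k)

fromℕ : ℕ → ℚ
fromℕ k = ℚ.fromℚᵘ (Data.Rational.Unnormalised.mkℚᵘ (Data.Integer.+ k) 0)
  where import Data.Rational.Unnormalised ; import Data.Integer

-- RatioBound k v C m a b  expresses  k / v ≥ C · m^(1/3 - a/b)
-- for v > 0, C > 0, m ≥ 1, by raising both sides to the
-- power 3b and multiplying by m^(3a):   (C·v)^(3b) · m^b ≤ k^(3b) · m^(3a).
RatioBound : ℕ → ℚ → ℚ → ℕ → ℕ → ℕ → Set
RatioBound k v C m a b =
  ((C ℚ.* v) ^ℚ (3 ℕ.* b)) ℚ.* (fromℕ m ^ℚ b)
    ℚ.≤ (fromℕ k ^ℚ (3 ℕ.* b)) ℚ.* (fromℕ m ^ℚ (3 ℕ.* a))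

-- Take a prime r and r internally disjoint s–t paths ("columns") of r steps each, every step
-- made of r parallel edges, so m = r³. The labels are the r² points of the plane over ℤ/r, and
-- the r parallel edges of step j of column c carry the line y = c x + j. Every s–t path runs
-- through a whole column, whose r steps carry distinct labels, so weight 1/r on every label is
-- feasible for LP2, with value r; the r paths along column 0 through the edges of a fixed index
-- x have disjoint label sets, so no feasible solution is cheaper. A label cut must contain a
-- whole line of every slope, and lines of distinct slopes meet at most once, so a cut has at
-- least r²/2 labels. Hence OPT / OPT_f ≥ r / 2 = m^(1/3) / 2 ≥ m^(1/3 − a/b) once 2^b ≤ r.
module Submission where

open import Defs
open import Data.Nat using (ℕ; suc)
open import Data.Fin using (Fin)

module Primes where

  open import Data.Nat
  open import Data.Nat.Properties
  open import Data.Nat.Divisibility using (_∣_; ∣⇒≤; ∣-trans; ∣m+n∣m⇒∣n; m∣m*n; m≤n⇒m!∣n!)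
  open import Data.Nat.Primality using (Prime; prime⇒nonTrivial; prime⇒nonZero)
  open import Data.Nat.Primality.Factorisation using (factorise)
  open import Data.List using ([]; _∷_)
  open import Data.List.Relation.Unary.All using (_∷_)
  open import Data.Product using (∃-syntax; _×_; _,_)
  open import Relation.Binary.PropositionalEquality
  open import Relation.Nullary using (contradiction)

  n∣n! : ∀ n → .{{NonZero n}} → n ∣ n !
  n∣n! (suc n) = m∣m*n (n !)

  -- Euclid: a prime factor of n! + 1 exceeds n.
  ∃-prime> : ∀ n → ∃[ p ] Prime p × n < p
  ∃-prime> n with factorise (1 + n !) {{_}}
  ... | record { factors = [] ; isFactorisation = n!+1≡1 } =
    contradiction (suc-injective n!+1≡1) (≢-nonZero⁻¹ (n !) {{n !≢0}})
  ... | record { factors = p ∷ ps ; isFactorisation = n!+1≡p*ps ; factorsPrime = prime-p ∷ _ } =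
    p , prime-p , ≰⇒> p≰n
    where
    p≰n : p ≰ n
    p≰n p≤n = <⇒≱ (nonTrivial⇒n>1 p {{prime⇒nonTrivial prime-p}}) (∣⇒≤ p∣1)
      where
      p∣n! : p ∣ n !
      p∣n! = ∣-trans (n∣n! p {{prime⇒nonZero prime-p}}) (m≤n⇒m!∣n! p≤n)
      p∣1 : p ∣ 1
      p∣1 = ∣m+n∣m⇒∣n (subst (p ∣_) (trans (sym n!+1≡p*ps) (+-comm 1 (n !))) (m∣m*n _)) p∣n!

-- Congruences modulo p are handled as divisibility of integer differences.
module Residues where

  open import Data.Nat
  open import Data.Nat.Properties
  open import Data.Nat.DivMod using (_%_; _/_; m≡m%n+[m/n]*n)
  open import Data.Nat.Divisibility using (_∣_; ∣⇒≤)
  open import Data.Nat.Primality using (Prime; euclidsLemma)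
  open import Data.Integer using (+_; _⊖_)
  import Data.Integer as ℤ
  import Data.Integer.Properties as ℤ
  open import Data.Integer.Divisibility.Signed using (divides; ∣⇒∣ᵤ; ∣ᵤ⇒∣; ∣m∣n⇒∣m-n)
    renaming (_∣_ to _∣ℤ_)
  open import Data.Integer.Solver using (module +-*-Solver)
  open import Data.Sum using (_⊎_; map)
  open import Relation.Binary.PropositionalEquality
  open import Relation.Nullary using (contradiction)
  open +-*-Solver

  ∣m⊖n∣≡∣m-n∣ : ∀ m n → ℤ.∣ m ⊖ n ∣ ≡ ∣ m - n ∣
  ∣m⊖n∣≡∣m-n∣ zero    zero    = refl
  ∣m⊖n∣≡∣m-n∣ zero    (suc n) = refl
  ∣m⊖n∣≡∣m-n∣ (suc m) zero    = refl
  ∣m⊖n∣≡∣m-n∣ (suc m) (suc n) = trans (cong ℤ.∣_∣ (ℤ.[1+m]⊖[1+n]≡m⊖n m n)) (∣m⊖n∣≡∣m-n∣ m n)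

  ∣+m-+n∣≡∣m-n∣ : ∀ m n → ℤ.∣ + m ℤ.- + n ∣ ≡ ∣ m - n ∣
  ∣+m-+n∣≡∣m-n∣ m n = trans (cong ℤ.∣_∣ (ℤ.m-n≡m⊖n m n)) (∣m⊖n∣≡∣m-n∣ m n)

  ∣∧<⇒≡0 : ∀ {p n} → p ∣ n → n < p → n ≡ 0
  ∣∧<⇒≡0 {n = zero}  _   _   = refl
  ∣∧<⇒≡0 {n = suc n} p∣n n<p = contradiction (∣⇒≤ p∣n) (<⇒≱ n<p)

  residue-unique : ∀ {p m n} → + p ∣ℤ + m ℤ.- + n → m < p → n < p → m ≡ n
  residue-unique {p} {m} {n} p∣m-n m<p n<p = ∣m-n∣≡0⇒m≡n (∣∧<⇒≡0 p∣∣m-n∣ ∣m-n∣<p)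
    where
    p∣∣m-n∣ : p ∣ ∣ m - n ∣
    p∣∣m-n∣ = subst (p ∣_) (∣+m-+n∣≡∣m-n∣ m n) (∣⇒∣ᵤ p∣m-n)
    ∣m-n∣<p : ∣ m - n ∣ < p
    ∣m-n∣<p = ≤-<-trans (∣m-n∣≤m⊔n m n) (⊔-lub m<p n<p)

  %-≡⇒∣- : ∀ {p} .{{_ : NonZero p}} {m n} → m % p ≡ n % p → + p ∣ℤ + m ℤ.- + n
  %-≡⇒∣- {p} {m} {n} eq = divides (+ (m / p) ℤ.- + (n / p)) (begin
    + m ℤ.- + n
      ≡⟨ cong₂ ℤ._-_ (split m) (split n) ⟩
    (+ (m % p) ℤ.+ + (m / p) ℤ.* + p) ℤ.- (+ (n % p) ℤ.+ + (n / p) ℤ.* + p)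
      ≡⟨ cong (λ k → (+ k ℤ.+ + (m / p) ℤ.* + p) ℤ.- (+ (n % p) ℤ.+ + (n / p) ℤ.* + p)) eq ⟩
    (+ (n % p) ℤ.+ + (m / p) ℤ.* + p) ℤ.- (+ (n % p) ℤ.+ + (n / p) ℤ.* + p)
      ≡⟨ solve 4 (λ k a b p → (k :+ a :* p) :- (k :+ b :* p) := (a :- b) :* p) refl
           (+ (n % p)) (+ (m / p)) (+ (n / p)) (+ p) ⟩
    (+ (m / p) ℤ.- + (n / p)) ℤ.* + p ∎)
    where
    open ≡-Reasoning
    split : ∀ k → + k ≡ + (k % p) ℤ.+ + (k / p) ℤ.* + p
    split k = trans (cong +_ (m≡m%n+[m/n]*n k p))
                    (trans (ℤ.pos-+ (k % p) _) (cong (ℤ._+_ (+ (k % p))) (ℤ.pos-* (k / p) p)))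

  prime-∣ℤ-* : ∀ {p} → Prime p → ∀ i j → + p ∣ℤ i ℤ.* j → + p ∣ℤ i ⊎ + p ∣ℤ j
  prime-∣ℤ-* prime-p i j p∣ij = map ∣ᵤ⇒∣ ∣ᵤ⇒∣
    (euclidsLemma ℤ.∣ i ∣ ℤ.∣ j ∣ prime-p (subst (_ ∣_) (ℤ.abs-* i j) (∣⇒∣ᵤ p∣ij)))

  +[m*n+o] : ∀ m n o → + (m * n + o) ≡ + m ℤ.* + n ℤ.+ + o
  +[m*n+o] m n o = trans (ℤ.pos-+ (m * n) o) (cong (ℤ._+ + o) (ℤ.pos-* m n))

  %-+-cancelˡ : ∀ {p} .{{_ : NonZero p}} a {j j′} → (a + j) % p ≡ (a + j′) % p →
                j < p → j′ < p → j ≡ j′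
  %-+-cancelˡ {p} a {j} {j′} eq = residue-unique (subst (+ p ∣ℤ_) difference (%-≡⇒∣- eq))
    where
    difference : + (a + j) ℤ.- + (a + j′) ≡ + j ℤ.- + j′
    difference = trans (cong₂ ℤ._-_ (ℤ.pos-+ a j) (ℤ.pos-+ a j′))
      (solve 3 (λ a j j′ → (a :+ j) :- (a :+ j′) := j :- j′) refl (+ a) (+ j) (+ j′))

  -- Subtracting the congruences at x and at x′ leaves p ∣ (c − c′)(x − x′).
  lines-meet-once : ∀ {p} .{{_ : NonZero p}} → Prime p → ∀ {c c′ j j′ x x′} →
    (c * x + j) % p ≡ (c′ * x + j′) % p → (c * x′ + j) % p ≡ (c′ * x′ + j′) % p →
    c < p → c′ < p → x < p → x′ < p → c ≡ c′ ⊎ x ≡ x′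
  lines-meet-once {p} prime-p {c} {c′} {j} {j′} {x} {x′} at-x at-x′ c<p c′<p x<p x′<p =
    map (λ p∣c-c′ → residue-unique p∣c-c′ c<p c′<p) (λ p∣x-x′ → residue-unique p∣x-x′ x<p x′<p)
        (prime-∣ℤ-* prime-p (+ c ℤ.- + c′) (+ x ℤ.- + x′) p∣product)
    where
    difference : (+ (c * x + j) ℤ.- + (c′ * x + j′)) ℤ.- (+ (c * x′ + j) ℤ.- + (c′ * x′ + j′))
               ≡ (+ c ℤ.- + c′) ℤ.* (+ x ℤ.- + x′)
    difference = trans
      (cong₂ ℤ._-_ (cong₂ ℤ._-_ (+[m*n+o] c x j) (+[m*n+o] c′ x j′))
                   (cong₂ ℤ._-_ (+[m*n+o] c x′ j) (+[m*n+o] c′ x′ j′)))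
      (solve 6 (λ c c′ j j′ x x′ →
          (c :* x :+ j :- (c′ :* x :+ j′)) :- (c :* x′ :+ j :- (c′ :* x′ :+ j′))
            := (c :- c′) :* (x :- x′)) refl (+ c) (+ c′) (+ j) (+ j′) (+ x) (+ x′))
    p∣product : + p ∣ℤ (+ c ℤ.- + c′) ℤ.* (+ x ℤ.- + x′)
    p∣product = subst (+ p ∣ℤ_) difference (∣m∣n⇒∣m-n (%-≡⇒∣- at-x) (%-≡⇒∣- at-x′))

module Counting where

  open import Data.Nat
  open import Data.Nat.Properties
  open import Data.Nat.Solver using (module +-*-Solver)
  open import Data.Fin using (Fin; zero; suc)
  open import Data.Fin.Properties using () renaming (_≟_ to _≟ᶠ_)
  open import Data.Fin.Subset using (Subset; ∣_∣; _∈_; inside; outside)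
  open import Data.Vec using (_∷_; []; lookup)
  open import Data.Vec.Properties using ([]=⇒lookup)
  open import Data.Bool using (Bool; true; false; if_then_else_)
  open import Data.Product using (∃-syntax; _,_)
  open import Function using (_∘_; case_of_)
  open import Relation.Binary.PropositionalEquality
  open import Relation.Nullary using (does; yes; no; contradiction)
  import Algebra.Properties.Semiring.Sum as SemiringSum

  module ℕΣ = SemiringSum +-*-semiring
  open ℕΣ public using (sum; sum-syntax; sum-cong-≗)
  open ℕΣ using (∑-comm; ∑-distrib-+; *-distribˡ-sum; *-distribʳ-sum)

  indicator : Bool → ℕ
  indicator b = if b then 1 else 0

  count : ∀ {n} → (Fin n → Bool) → ℕ
  count {n} b = ∑[ i < n ] indicator (b i)

  δ : ∀ {n} → Fin n → Fin n → ℕ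
  δ i j = indicator (does (i ≟ᶠ j))

  δ-sym : ∀ {n} (i j : Fin n) → δ i j ≡ δ j i
  δ-sym i j with i ≟ᶠ j | j ≟ᶠ i
  ... | yes _ | yes _ = refl
  ... | no _ | no _ = refl
  ... | yes i≡j | no j≢i = contradiction (sym i≡j) j≢i
  ... | no i≢j | yes j≡i = contradiction (sym j≡i) i≢j

  δ-pos : ∀ {n} {i j : Fin n} → 0 < δ i j → i ≡ j
  δ-pos {i = i} {j} δ>0 with i ≟ᶠ j
  ... | yes i≡j = i≡j
  ... | no _ = contradiction δ>0 (<-irrefl refl)

  δ≤1 : ∀ {n} (i j : Fin n) → δ i j ≤ 1
  δ≤1 i j with i ≟ᶠ j
  ... | yes _ = ≤-refl
  ... | no _ = z≤n

  sum-const : ∀ n c → sum {n} (λ _ → c) ≡ n * c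
  sum-const zero    c = refl
  sum-const (suc n) c = cong (c +_) (sum-const n c)

  sum-mono-≤ : ∀ {n} {f g : Fin n → ℕ} → (∀ i → f i ≤ g i) → sum f ≤ sum g
  sum-mono-≤ {zero}  f≤g = z≤n
  sum-mono-≤ {suc n} f≤g = +-mono-≤ (f≤g zero) (sum-mono-≤ (f≤g ∘ suc))

  sum-δ : ∀ {n} (j : Fin n) → sum (λ i → δ i j) ≡ 1
  sum-δ {suc n} zero    = cong suc (trans (sum-const n 0) (*-zeroʳ n))
  sum-δ {suc n} (suc j) = sum-δ j

  sum-pos : ∀ {n} (f : Fin n → ℕ) → 0 < sum f → ∃[ i ] 0 < f i
  sum-pos {suc n} f sum>0 with f zero in fzero≡
  ... | suc _ = zero , subst (0 <_) (sym fzero≡) z<s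
  ... | zero with sum-pos (f ∘ suc) sum>0
  ...   | i , fi>0 = suc i , fi>0

  sum-≤1 : ∀ {n} {f : Fin n → ℕ} → (∀ i → f i ≤ 1) →
           (∀ i j → 0 < f i → 0 < f j → i ≡ j) → sum f ≤ 1
  sum-≤1 {f = f} f≤1 unique with 0 <? sum f
  ... | no sum≯0 = ≤-trans (≮⇒≥ sum≯0) z≤n
  ... | yes sum>0 with sum-pos f sum>0
  ...   | i , fi>0 = begin
    sum f           ≤⟨ sum-mono-≤ f≤δ ⟩
    sum (δ i)       ≡⟨ sum-cong-≗ (δ-sym i) ⟩
    sum (λ j → δ j i) ≡⟨ sum-δ i ⟩
    1               ∎
    where
    open ≤-Reasoning
    f≤δ : ∀ j → f j ≤ δ i j
    f≤δ j with i ≟ᶠ j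
    ... | yes refl = f≤1 j
    ... | no i≢j = ≮⇒≥ (λ fj>0 → i≢j (unique i j fi>0 fj>0))

  sum-δ-δ : ∀ {n} (u v : Fin n) → sum (λ ℓ → δ ℓ u * δ ℓ v) ≡ δ u v
  sum-δ-δ u v = begin
    sum (λ ℓ → δ ℓ u * δ ℓ v) ≡⟨ sum-cong-≗ select ⟩
    sum (λ ℓ → δ ℓ u * δ u v) ≡⟨ *-distribʳ-sum (δ u v) (λ ℓ → δ ℓ u) ⟨
    sum (λ ℓ → δ ℓ u) * δ u v ≡⟨ cong (_* δ u v) (sum-δ u) ⟩
    1 * δ u v                 ≡⟨ *-identityˡ (δ u v) ⟩
    δ u v                     ∎
    where
    open ≡-Reasoning
    select : ∀ ℓ → δ ℓ u * δ ℓ v ≡ δ ℓ u * δ u v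
    select ℓ with ℓ ≟ᶠ u
    ... | yes refl = refl
    ... | no _ = refl

  sum-*-sum : ∀ {m n} (f : Fin m → ℕ) (g : Fin n → ℕ) →
              sum f * sum g ≡ ∑[ i < m ] ∑[ j < n ] (f i * g j)
  sum-*-sum f g = trans (*-distribʳ-sum (sum g) f) (sum-cong-≗ (λ i → *-distribˡ-sum (f i) g))

  injective⇒≤count : ∀ {r q} (b : Fin q → Bool) (g : Fin r → Fin q) → (∀ {i j} → g i ≡ g j → i ≡ j) →
                     (∀ j → b (g j) ≡ true) → r ≤ count b
  injective⇒≤count {r} {q} b g g-injective b∘g = begin
    r                                 ≡⟨ trans (sum-const r 1) (*-identityʳ r) ⟨
    ∑[ j < r ] 1                      ≡⟨ sum-cong-≗ (λ j → sum-δ (g j)) ⟨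
    ∑[ j < r ] ∑[ ℓ < q ] δ ℓ (g j)   ≡⟨ ∑-comm (λ j ℓ → δ ℓ (g j)) ⟩
    ∑[ ℓ < q ] ∑[ j < r ] δ ℓ (g j)   ≤⟨ sum-mono-≤ preimages≤indicator ⟩
    count b                           ∎
    where
    open ≤-Reasoning
    preimages≤indicator : ∀ ℓ → ∑[ j < r ] δ ℓ (g j) ≤ indicator (b ℓ)
    preimages≤indicator ℓ with b ℓ in bℓ≡
    ... | true  = sum-≤1 {f = λ j → δ ℓ (g j)} (λ j → δ≤1 ℓ (g j))
                    (λ i j p q → g-injective (trans (sym (δ-pos {i = ℓ} p)) (δ-pos {i = ℓ} q)))
    ... | false = ≮⇒≥ λ sum>0 → case sum-pos (λ j → δ ℓ (g j)) sum>0 of λ where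
                    (j , δ>0) → contradiction (trans (sym bℓ≡) (trans (cong b (δ-pos {i = ℓ} δ>0)) (b∘g j))) λ ()

  ∣p∣≡count : ∀ {n} (p : Subset n) → ∣ p ∣ ≡ count (lookup p)
  ∣p∣≡count []             = refl
  ∣p∣≡count (inside ∷ p)   = cong suc (∣p∣≡count p)
  ∣p∣≡count (outside ∷ p)  = ∣p∣≡count p

  sum-pull₂ : ∀ {l m n} (F : Fin l → Fin m → Fin n → ℕ) →
              ∑[ ℓ < l ] ∑[ i < m ] ∑[ j < n ] F ℓ i j ≡ ∑[ i < m ] ∑[ j < n ] ∑[ ℓ < l ] F ℓ i j
  sum-pull₂ F = trans (∑-comm (λ ℓ i → sum (F ℓ i))) (sum-cong-≗ (λ i → ∑-comm (λ ℓ j → F ℓ i j)))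

  sum-multiplicity-* : ∀ {m n q} (u : Fin m → Fin q) (v : Fin n → Fin q) →
    ∑[ ℓ < q ] (∑[ i < m ] δ ℓ (u i) * ∑[ j < n ] δ ℓ (v j)) ≡ ∑[ i < m ] ∑[ j < n ] δ (u i) (v j)
  sum-multiplicity-* {m} {n} {q} u v = begin
    ∑[ ℓ < q ] (∑[ i < m ] δ ℓ (u i) * ∑[ j < n ] δ ℓ (v j))
      ≡⟨ sum-cong-≗ (λ ℓ → sum-*-sum (λ i → δ ℓ (u i)) (λ j → δ ℓ (v j))) ⟩
    ∑[ ℓ < q ] ∑[ i < m ] ∑[ j < n ] (δ ℓ (u i) * δ ℓ (v j))
      ≡⟨ sum-pull₂ (λ ℓ i j → δ ℓ (u i) * δ ℓ (v j)) ⟩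
    ∑[ i < m ] ∑[ j < n ] ∑[ ℓ < q ] (δ ℓ (u i) * δ ℓ (v j))
      ≡⟨ sum-cong-≗ (λ i → sum-cong-≗ (λ j → sum-δ-δ (u i) (v j))) ⟩
    ∑[ i < m ] ∑[ j < n ] δ (u i) (v j) ∎
    where open ≡-Reasoning

  3m≤2+m*m : ∀ m → 3 * m ≤ 2 + m * m
  3m≤2+m*m 0 = z≤n
  3m≤2+m*m 1 = ≤-refl
  3m≤2+m*m 2 = ≤-refl
  3m≤2+m*m (suc (suc (suc k))) = ≤-trans (*-monoˡ-≤ (3 + k) (m≤m+n 3 k)) (m≤n+m _ 2)

  module BlockCovering {a b q} (pt : Fin a → Fin b → Fin q)
    (injective-in-block : ∀ c {x y} → pt c x ≡ pt c y → x ≡ y)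
    (blocks-meet-once : ∀ {c c′} → c ≢ c′ →
                        ∀ {x x′ y y′} → pt c x ≡ pt c′ x′ → pt c y ≡ pt c′ y′ → x ≡ y)
    where

    multiplicity : Fin q → ℕ
    multiplicity ℓ = ∑[ c < a ] ∑[ x < b ] δ ℓ (pt c x)

    coincidences : Fin a → Fin a → ℕ
    coincidences c c′ = ∑[ x < b ] ∑[ x′ < b ] δ (pt c x) (pt c′ x′)

    sum-multiplicity : sum multiplicity ≡ a * b
    sum-multiplicity = begin
      sum multiplicity                                ≡⟨ sum-pull₂ (λ ℓ c x → δ ℓ (pt c x)) ⟩
      ∑[ c < a ] ∑[ x < b ] ∑[ ℓ < q ] δ ℓ (pt c x)   ≡⟨ sum-cong-≗ (λ c → sum-cong-≗ (λ x → sum-δ (pt c x))) ⟩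
      ∑[ c < a ] ∑[ x < b ] 1                         ≡⟨ sum-cong-≗ {a} (λ c → trans (sum-const b 1) (*-identityʳ b)) ⟩
      ∑[ c < a ] b                                    ≡⟨ sum-const a b ⟩
      a * b                                           ∎
      where open ≡-Reasoning

    sum-multiplicity² : ∑[ ℓ < q ] (multiplicity ℓ * multiplicity ℓ) ≡ ∑[ c < a ] ∑[ c′ < a ] coincidences c c′
    sum-multiplicity² = begin
      ∑[ ℓ < q ] (multiplicity ℓ * multiplicity ℓ)
        ≡⟨ sum-cong-≗ (λ ℓ → sum-*-sum (ind ℓ) (ind ℓ)) ⟩
      ∑[ ℓ < q ] ∑[ c < a ] ∑[ c′ < a ] (ind ℓ c * ind ℓ c′)
        ≡⟨ sum-pull₂ (λ ℓ c c′ → ind ℓ c * ind ℓ c′) ⟩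
      ∑[ c < a ] ∑[ c′ < a ] ∑[ ℓ < q ] (ind ℓ c * ind ℓ c′)
        ≡⟨ sum-cong-≗ (λ c → sum-cong-≗ (λ c′ → sum-multiplicity-* (pt c) (pt c′))) ⟩
      ∑[ c < a ] ∑[ c′ < a ] coincidences c c′ ∎
      where
      open ≡-Reasoning
      ind : Fin q → Fin a → ℕ
      ind ℓ c = ∑[ x < b ] δ ℓ (pt c x)

    row-≤1 : ∀ c c′ x → ∑[ x′ < b ] δ (pt c x) (pt c′ x′) ≤ 1
    row-≤1 c c′ x = sum-≤1 {f = λ x′ → δ (pt c x) (pt c′ x′)} (λ x′ → δ≤1 (pt c x) (pt c′ x′))
      (λ x′ y′ p q → injective-in-block c′ (trans (sym (δ-pos {i = pt c x} p)) (δ-pos {i = pt c x} q)))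

    coincidences-≤ : ∀ c c′ → coincidences c c′ ≤ 1 + b * δ c c′
    coincidences-≤ c c′ with c ≟ᶠ c′
    ... | yes refl = ≤-trans (sum-mono-≤ (row-≤1 c c)) (≤-trans (≤-reflexive (sum-const b 1)) (n≤1+n _))
    ... | no c≢c′ = ≤-trans (sum-≤1 (row-≤1 c c′) meet) (m≤m+n 1 _)
      where
      meet : ∀ x y → 0 < ∑[ x′ < b ] δ (pt c x) (pt c′ x′) → 0 < ∑[ y′ < b ] δ (pt c y) (pt c′ y′) → x ≡ y
      meet x y row-x row-y with sum-pos (λ x′ → δ (pt c x) (pt c′ x′)) row-x
                              | sum-pos (λ y′ → δ (pt c y) (pt c′ y′)) row-y
      ... | x′ , px | y′ , py = blocks-meet-once c≢c′ (δ-pos px) (δ-pos py)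

    sum-multiplicity²-≤ : ∑[ ℓ < q ] (multiplicity ℓ * multiplicity ℓ) ≤ a * a + a * b
    sum-multiplicity²-≤ = begin
      ∑[ ℓ < q ] (multiplicity ℓ * multiplicity ℓ) ≡⟨ sum-multiplicity² ⟩
      ∑[ c < a ] ∑[ c′ < a ] coincidences c c′     ≤⟨ sum-mono-≤ (λ c → sum-mono-≤ (coincidences-≤ c)) ⟩
      ∑[ c < a ] ∑[ c′ < a ] (1 + b * δ c c′)      ≡⟨ sum-cong-≗ {a} row ⟩
      ∑[ c < a ] (a + b)                          ≡⟨ sum-const a (a + b) ⟩
      a * (a + b)                                 ≡⟨ *-distribˡ-+ a a b ⟩
      a * a + a * b                               ∎
      where
      open ≤-Reasoning
      row : ∀ c → ∑[ c′ < a ] (1 + b * δ c c′) ≡ a + b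
      row c = begin-equality
        ∑[ c′ < a ] (1 + b * δ c c′)            ≡⟨ ∑-distrib-+ (λ _ → 1) (λ c′ → b * δ c c′) ⟩
        ∑[ c′ < a ] 1 + ∑[ c′ < a ] (b * δ c c′) ≡⟨ cong₂ _+_ (trans (sum-const a 1) (*-identityʳ a))
                                                              (sym (*-distribˡ-sum b (δ c))) ⟩
        a + b * ∑[ c′ < a ] δ c c′              ≡⟨ cong (λ k → a + b * k) (trans (sum-cong-≗ (δ-sym c)) (sum-δ c)) ⟩
        a + b * 1                               ≡⟨ cong (a +_) (*-identityʳ b) ⟩
        a + b                                   ∎

    multiplicity>0⇒point : ∀ ℓ → 0 < multiplicity ℓ → ∃[ c ] ∃[ x ] ℓ ≡ pt c x
    multiplicity>0⇒point ℓ mult>0 with sum-pos _ mult>0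
    ... | c , ind>0 with sum-pos (λ x → δ ℓ (pt c x)) ind>0
    ...   | x , δ>0 = c , x , δ-pos {i = ℓ} δ>0

    module _ (L : Subset q) (points∈L : ∀ c x → pt c x ∈ L) where

      3mult≤2+mult² : ∀ ℓ → 3 * multiplicity ℓ ≤ 2 * indicator (lookup L ℓ) + multiplicity ℓ * multiplicity ℓ
      3mult≤2+mult² ℓ with multiplicity ℓ | multiplicity>0⇒point ℓ
      ... | zero  | _ = z≤n
      ... | suc k | point with point z<s
      ...   | c , x , refl rewrite []=⇒lookup (points∈L c x) = 3m≤2+m*m (suc k)

      -- Double counting: the multiplicities m of the points sum to a b, their squares to at most
      -- a a + a b, and 3 m ≤ 2 + m² for every covered point.
      cover-size : 2 * (a * b) ≤ 2 * ∣ L ∣ + a * a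
      cover-size = +-cancelʳ-≤ (a * b) _ _ (begin
        2 * (a * b) + a * b                                 ≡⟨ solve 1 (λ n → con 2 :* n :+ n := con 3 :* n)
                                                                       refl (a * b) ⟩
        3 * (a * b)                                         ≡⟨ cong (3 *_) sum-multiplicity ⟨
        3 * sum multiplicity                                ≡⟨ *-distribˡ-sum 3 multiplicity ⟩
        ∑[ ℓ < q ] (3 * multiplicity ℓ)                     ≤⟨ sum-mono-≤ 3mult≤2+mult² ⟩
        ∑[ ℓ < q ] (2 * indicator (lookup L ℓ) + multiplicity ℓ * multiplicity ℓ)
                                                            ≡⟨ ∑-distrib-+ (λ ℓ → 2 * indicator (lookup L ℓ)) _ ⟩
        ∑[ ℓ < q ] (2 * indicator (lookup L ℓ)) + ∑[ ℓ < q ] (multiplicity ℓ * multiplicity ℓ)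
                                                            ≡⟨ cong (_+ _) (trans (cong (2 *_) (∣p∣≡count L))
                                                                    (*-distribˡ-sum 2 (indicator ∘ lookup L))) ⟨
        2 * ∣ L ∣ + ∑[ ℓ < q ] (multiplicity ℓ * multiplicity ℓ)
                                                            ≤⟨ +-monoʳ-≤ (2 * ∣ L ∣) sum-multiplicity²-≤ ⟩
        2 * ∣ L ∣ + (a * a + a * b)                         ≡⟨ +-assoc (2 * ∣ L ∣) (a * a) (a * b) ⟨
        2 * ∣ L ∣ + a * a + a * b                           ∎)
        where
        open ≤-Reasoning
        open +-*-Solver

module Rationals where

  open import Data.Nat as ℕ using (ℕ; zero; suc)
  import Data.Nat.Properties as ℕ
  open import Data.Fin using (Fin; zero; suc)
  open import Data.Bool using (true; false; if_then_else_)
  open import Data.Integer using (+_)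
  import Data.Integer as ℤ
  import Data.Integer.Properties as ℤ
  open import Data.Integer.Solver using (module +-*-Solver)
  open import Data.Rational using (ℚ; 0ℚ; 1ℚ; _+_; _*_; _≤_; _<_; toℚᵘ)
  open import Data.Rational.Properties
  open import Data.Rational.Unnormalised as ℚᵘ using (mkℚᵘ; *≡*)
  import Data.Rational.Unnormalised.Properties as ℚᵘ
  open import Relation.Binary.PropositionalEquality
  open import Algebra.Bundles using (CommutativeRing)
  import Algebra.Properties.Semiring.Sum as SemiringSum
  open Counting using (indicator)

  fromℕ-suc : ∀ n → fromℕ (suc n) ≡ 1ℚ + fromℕ n
  fromℕ-suc n = toℚᵘ-injective (begin
    toℚᵘ (fromℕ (suc n))                   ≈⟨ toℚᵘ-fromℚᵘ (mkℚᵘ (+ suc n) 0) ⟩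
    mkℚᵘ (+ suc n) 0                       ≈⟨ split ⟩
    mkℚᵘ (+ 1) 0 ℚᵘ.+ mkℚᵘ (+ n) 0         ≈⟨ ℚᵘ.+-congʳ (toℚᵘ 1ℚ) (toℚᵘ-fromℚᵘ (mkℚᵘ (+ n) 0)) ⟨
    toℚᵘ 1ℚ ℚᵘ.+ toℚᵘ (fromℕ n)            ≈⟨ toℚᵘ-homo-+ 1ℚ (fromℕ n) ⟨
    toℚᵘ (1ℚ + fromℕ n)                    ∎)
    where
    open ℚᵘ.≃-Reasoning
    split : mkℚᵘ (+ suc n) 0 ℚᵘ.≃ mkℚᵘ (+ 1) 0 ℚᵘ.+ mkℚᵘ (+ n) 0
    split = *≡* (trans (cong (ℤ._* + 1) (ℤ.pos-+ 1 n))
      (solve 1 (λ n → (con (+ 1) :+ n) :* con (+ 1)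
                        := (con (+ 1) :* con (+ 1) :+ n :* con (+ 1)) :* con (+ 1)) refl (+ n)))
      where open +-*-Solver

  fromℕ-+ : ∀ m n → fromℕ (m ℕ.+ n) ≡ fromℕ m + fromℕ n
  fromℕ-+ zero    n = sym (+-identityˡ (fromℕ n))
  fromℕ-+ (suc m) n = begin
    fromℕ (suc (m ℕ.+ n))       ≡⟨ fromℕ-suc (m ℕ.+ n) ⟩
    1ℚ + fromℕ (m ℕ.+ n)        ≡⟨ cong (_+_ 1ℚ) (fromℕ-+ m n) ⟩
    1ℚ + (fromℕ m + fromℕ n)    ≡⟨ +-assoc 1ℚ (fromℕ m) (fromℕ n) ⟨
    1ℚ + fromℕ m + fromℕ n      ≡⟨ cong (_+ fromℕ n) (fromℕ-suc m) ⟨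
    fromℕ (suc m) + fromℕ n     ∎
    where open ≡-Reasoning

  fromℕ-* : ∀ m n → fromℕ (m ℕ.* n) ≡ fromℕ m * fromℕ n
  fromℕ-* zero    n = sym (*-zeroˡ (fromℕ n))
  fromℕ-* (suc m) n = begin
    fromℕ (n ℕ.+ m ℕ.* n)             ≡⟨ fromℕ-+ n (m ℕ.* n) ⟩
    fromℕ n + fromℕ (m ℕ.* n)         ≡⟨ cong₂ _+_ (*-identityˡ (fromℕ n)) (sym (fromℕ-* m n)) ⟨
    1ℚ * fromℕ n + fromℕ m * fromℕ n  ≡⟨ *-distribʳ-+ (fromℕ n) 1ℚ (fromℕ m) ⟨
    (1ℚ + fromℕ m) * fromℕ n          ≡⟨ cong (_* fromℕ n) (fromℕ-suc m) ⟨
    fromℕ (suc m) * fromℕ n           ∎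
    where open ≡-Reasoning

  fromℕ-^ : ∀ m n → fromℕ (m ℕ.^ n) ≡ fromℕ m ^ℚ n
  fromℕ-^ m zero    = refl
  fromℕ-^ m (suc n) = trans (fromℕ-* m (m ℕ.^ n)) (cong (fromℕ m *_) (fromℕ-^ m n))

  fromℕ-nonNeg : ∀ n → 0ℚ ≤ fromℕ n
  fromℕ-nonNeg n = nonNegative⁻¹ (fromℕ n) {{normalize-nonNeg n 1}}

  fromℕ-pos : ∀ n → 0ℚ < fromℕ (suc n)
  fromℕ-pos n = positive⁻¹ (fromℕ (suc n)) {{normalize-pos (suc n) 1}}

  fromℕ-mono-≤ : ∀ {m n} → m ℕ.≤ n → fromℕ m ≤ fromℕ n
  fromℕ-mono-≤ {m} {n} m≤n = begin
    fromℕ m                    ≡⟨ +-identityʳ (fromℕ m) ⟨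
    fromℕ m + 0ℚ               ≤⟨ +-monoʳ-≤ (fromℕ m) (fromℕ-nonNeg (n ℕ.∸ m)) ⟩
    fromℕ m + fromℕ (n ℕ.∸ m)  ≡⟨ fromℕ-+ m (n ℕ.∸ m) ⟨
    fromℕ (m ℕ.+ (n ℕ.∸ m))    ≡⟨ cong fromℕ (ℕ.m+[n∸m]≡n m≤n) ⟩
    fromℕ n                    ∎
    where open ≤-Reasoning

  module ℚΣ = SemiringSum (CommutativeRing.semiring +-*-commutativeRing)

  sumℚ≡sum : ∀ {m} (I : Instance m) {n} (f : Fin n → ℚ) → sumℚ I f ≡ ℚΣ.sum f
  sumℚ≡sum I {zero}  f = refl
  sumℚ≡sum I {suc n} f = cong (_+_ (f zero)) (sumℚ≡sum I (λ i → f (suc i)))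

  sumℚ-mono-≤ : ∀ {n} {f g : Fin n → ℚ} → (∀ i → f i ≤ g i) → ℚΣ.sum f ≤ ℚΣ.sum g
  sumℚ-mono-≤ {zero}  f≤g = ≤-refl
  sumℚ-mono-≤ {suc n} f≤g = +-mono-≤ (f≤g zero) (sumℚ-mono-≤ (λ i → f≤g (suc i)))

  sumℚ-fromℕ-* : ∀ {n} (f : Fin n → ℕ) c → ℚΣ.sum (λ i → fromℕ (f i) * c) ≡ fromℕ (Counting.sum f) * c
  sumℚ-fromℕ-* {zero}  f c = sym (*-zeroˡ c)
  sumℚ-fromℕ-* {suc n} f c = begin
    fromℕ (f zero) * c + ℚΣ.sum (λ i → fromℕ (f (suc i)) * c)
      ≡⟨ cong (_+_ (fromℕ (f zero) * c)) (sumℚ-fromℕ-* (λ i → f (suc i)) c) ⟩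
    fromℕ (f zero) * c + fromℕ (Counting.sum (λ i → f (suc i))) * c
      ≡⟨ *-distribʳ-+ c (fromℕ (f zero)) _ ⟨
    (fromℕ (f zero) + fromℕ (Counting.sum (λ i → f (suc i)))) * c
      ≡⟨ cong (_* c) (fromℕ-+ (f zero) _) ⟨
    fromℕ (f zero ℕ.+ Counting.sum (λ i → f (suc i))) * c ∎
    where open ≡-Reasoning

  sumℚ-const : ∀ n c → ℚΣ.sum {n} (λ _ → c) ≡ fromℕ n * c
  sumℚ-const n c = begin
    ℚΣ.sum {n} (λ _ → c)                    ≡⟨ ℚΣ.sum-cong-≗ {n} (λ _ → *-identityˡ c) ⟨
    ℚΣ.sum {n} (λ _ → fromℕ 1 * c)          ≡⟨ sumℚ-fromℕ-* {n} (λ _ → 1) c ⟩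
    fromℕ (Counting.sum {n} (λ _ → 1)) * c  ≡⟨ cong (λ k → fromℕ k * c)
                                                    (trans (Counting.sum-const n 1) (ℕ.*-identityʳ n)) ⟩
    fromℕ n * c                             ∎
    where open ≡-Reasoning

  if-then-0≡ : ∀ b c → (if b then c else 0ℚ) ≡ fromℕ (indicator b) * c
  if-then-0≡ true  c = sym (*-identityˡ c)
  if-then-0≡ false c = sym (*-zeroˡ c)

module Walks {m} (I : Instance m) where

  open import Data.Fin.Properties using () renaming (_≟_ to _≟ᶠ_)
  open import Data.Fin.Subset using (Subset; _∉_)
  open import Data.Vec using (tabulate)
  open import Data.Vec.Properties using ([]=⇒lookup; lookup⇒[]=; lookup∘tabulate)
  open import Data.List.Membership.Propositional using () renaming (_∈_ to _∈ₗ_)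
  open import Function using (case_of_)
  open import Data.Bool using (true; false; not)
  open import Data.List.Relation.Unary.All as All using (All; []; _∷_)
  open import Data.List.Relation.Unary.Any as Any using (Any; any?)
  open import Relation.Binary.PropositionalEquality
  open import Relation.Nullary using (yes; contradiction)
  open import Relation.Nullary.Decidable using (dec-true)
  open Instance I

  walk-reach : ∀ {L′ u v} → Reach I L′ u → (w : Walk I u v) →
               All (λ e → label e ∉ L′) (edges I w) → Reach I L′ v
  walk-reach ρ []            []            = ρ
  walk-reach ρ (e ∷⟨ a ⟩ w) (e∉L′ ∷ rest) = walk-reach (step e e∉L′ a ρ) w rest

  vertices-subst : ∀ {u v v′} (eq : v ≡ v′) (w : Walk I u v) → vertices I (subst (Walk I u) eq w) ≡ vertices I w
  vertices-subst refl w = refl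

  edges-subst : ∀ {u v v′} (eq : v ≡ v′) (w : Walk I u v) → edges I (subst (Walk I u) eq w) ≡ edges I w
  edges-subst refl w = refl

  occurs⇒any : ∀ {u v} (w : Walk I u v) {ℓ} → occurs I w ℓ ≡ true → Any (λ e → label e ≡ ℓ) (edges I w)
  occurs⇒any w {ℓ} occurs≡ with any? (λ e → label e ≟ᶠ ℓ) (edges I w)
  ... | yes found = found

  unused : ∀ {u v} → Walk I u v → Subset q
  unused w = tabulate (λ ℓ → not (occurs I w ℓ))

  ∉unused⇒occurs : ∀ {u v} (w : Walk I u v) {ℓ} → ℓ ∉ unused w → occurs I w ℓ ≡ true
  ∉unused⇒occurs w {ℓ} ℓ∉ with occurs I w ℓ in occurs≡
  ... | true  = refl
  ... | false = contradiction (lookup⇒[]= ℓ (unused w) (trans (lookup∘tabulate _ ℓ) (cong not occurs≡))) ℓ∉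

  labels∉unused : ∀ {u v} (w : Walk I u v) → All (λ e → label e ∉ unused w) (edges I w)
  labels∉unused w = All.tabulate λ {e} e∈w label∈unused →
    case trans (sym (cong not (occurs-label e∈w)))
               (trans (sym (lookup∘tabulate _ (label e))) ([]=⇒lookup label∈unused)) of λ ()
    where
    occurs-label : ∀ {e} → e ∈ₗ edges I w → occurs I w (label e) ≡ true
    occurs-label e∈w = dec-true (any? (λ e′ → label e′ ≟ᶠ _) (edges I w))
                                (Any.map (λ e≡e′ → cong label (sym e≡e′)) e∈w)

module Optimum where

  open import Data.Nat using (ℕ; zero; suc; _≤_; z≤n; s≤s; _≟_)
  open import Data.Fin.Subset using (∣_∣)
  open import Data.Fin.Subset.Properties using (anySubset?)
  open import Data.Product using (∃-syntax; _×_; _,_)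
  open import Relation.Binary.PropositionalEquality
  open import Relation.Nullary using (yes; no; contradiction)
  open import Relation.Nullary.Decidable using (_×-dec_)
  open import Relation.Unary using (Decidable)

  least-witness : ∀ {P : ℕ → Set} → Decidable P → ∀ {n} → P n → ∃[ k ] P k × (∀ {j} → P j → k ≤ j)
  least-witness P? {zero}  P0 = 0 , P0 , λ _ → z≤n
  least-witness {P} P? {suc n} Pn with P? 0
  ... | yes P0 = 0 , P0 , λ _ → z≤n
  ... | no ¬P0 with least-witness (λ j → P? (suc j)) Pn
  ...   | k , Pk+1 , least = suc k , Pk+1 , minimal
    where
    minimal : ∀ {j} → P j → suc k ≤ j
    minimal {zero}  P0   = contradiction P0 ¬P0
    minimal {suc j} Pj+1 = s≤s (least Pj+1)

  opt-exists : ∀ {m} (I : Instance m) → Decidable (IsLabelCut I) →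
               ∀ {L} → IsLabelCut I L → ∃[ k ] IsOPT I k
  opt-exists I cut? {L} L-cut with least-witness cut-of-size? (L , L-cut , refl)
    where
    cut-of-size? : Decidable (λ k → ∃[ L′ ] IsLabelCut I L′ × ∣ L′ ∣ ≡ k)
    cut-of-size? k = anySubset? (λ L′ → cut? L′ ×-dec (∣ L′ ∣ ≟ k))
  ... | k , optimal-cut , least = k , optimal-cut , λ L′ L′-cut → least (L′ , L′-cut , refl)

-- Edge (c , j , i) is the i-th of the r parallel edges forming step j of column c; it carries
-- label lab c j i.
module ColumnGraph (r₀ q : ℕ) (lab : Fin (suc r₀) → Fin (suc r₀) → Fin (suc r₀) → Fin q) where

  open import Data.Nat using (ℕ; zero; suc; _+_; _*_; _≤_; _<_; _<?_; s≤s⁻¹; z<s)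
  open import Data.Nat.Properties hiding (suc-injective)
  open import Data.Fin using (Fin; zero; suc; toℕ; fromℕ<; combine; remQuot)
  open import Data.Fin.Properties
    using (all?; any?; ¬∀⟶∃¬; toℕ-fromℕ<; toℕ<n; remQuot-combine; combine-remQuot; combine-injective;
           toℕ-injective; suc-injective)
  open import Data.Fin.Subset using (Subset; _∈_; _∉_; ⊤)
  open import Data.Fin.Subset.Properties using (_∈?_; ∈⊤)
  open import Data.Product using (_×_; _,_; map₂; ∃-syntax; proj₁; proj₂)
  open import Data.Product.Properties using (,-injectiveˡ; ,-injectiveʳ)
  open import Data.Sum using (_⊎_; inj₁; inj₂; map₁)
  open import Data.List.Relation.Unary.All as All using (All; []; _∷_)
  open import Data.List.Relation.Unary.AllPairs using ([]; _∷_)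
  open import Data.List.Relation.Unary.Unique.Propositional using (Unique)
  open import Relation.Binary.PropositionalEquality
  open import Relation.Nullary using (yes; no; contradiction)
  open import Relation.Nullary.Decidable using (Dec; map′; ¬?; decidable-stable)

  r : ℕ
  r = suc r₀

  s t : Fin (2 + r * r)
  s = zero
  t = suc zero

  -- Position k of column c, for 0 ≤ k ≤ r; positions 0 and r are s and t.
  pos : Fin r → ℕ → Fin (2 + r * r)
  pos c zero = s
  pos c (suc k) with suc k <? r
  ... | yes k+1<r = suc (suc (combine c (fromℕ< k+1<r)))
  ... | no _      = t

  edge : Fin r → Fin r → Fin r → Fin (r * (r * r))
  edge c j i = combine c (combine j i)

  decode : Fin (r * (r * r)) → Fin r × Fin r × Fin r
  decode e = map₂ (remQuot r) (remQuot (r * r) e)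

  G : Instance (r * (r * r))
  G = record
    { n = 2 + r * r ; q = q ; s = s ; t = t
    ; ends  = λ e → let (c , j , _) = decode e in pos c (toℕ j) , pos c (suc (toℕ j))
    ; label = λ e → let (c , j , i) = decode e in lab c j i
    }

  decode-edge : ∀ c j i → decode (edge c j i) ≡ (c , j , i)
  decode-edge c j i = trans (cong (map₂ (remQuot r)) (remQuot-combine c (combine j i)))
                            (cong (c ,_) (remQuot-combine j i))

  data EdgeView : Fin (r * (r * r)) → Set where
    ⟨_,_,_⟩ : ∀ c j i → EdgeView (edge c j i)

  view : ∀ e → EdgeView e
  view e = subst EdgeView edge-decode ⟨ c , j , i ⟩
    where
    c j i : Fin r
    c = proj₁ (decode e)
    j = proj₁ (proj₂ (decode e))
    i = proj₂ (proj₂ (decode e))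
    edge-decode : edge c j i ≡ e
    edge-decode = trans (cong (combine c) (combine-remQuot {r} r (proj₂ (remQuot {r} (r * r) e))))
                        (combine-remQuot {r} (r * r) e)

  ends-edge : ∀ c j i → Instance.ends G (edge c j i) ≡ (pos c (toℕ j) , pos c (suc (toℕ j)))
  ends-edge c j i = cong (λ (c , j , _) → pos c (toℕ j) , pos c (suc (toℕ j))) (decode-edge c j i)

  label-edge : ∀ c j i → Instance.label G (edge c j i) ≡ lab c j i
  label-edge c j i = cong (λ (c , j , i) → lab c j i) (decode-edge c j i)

  pos-r : ∀ c → pos c r ≡ t
  pos-r c with r <? r
  ... | yes r<r = contradiction r<r (<-irrefl refl)
  ... | no _    = refl

  pos≡s : ∀ {c k} → pos c k ≡ s → k ≡ 0
  pos≡s {c} {zero}  _ = refl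
  pos≡s {c} {suc k} eq with suc k <? r
  pos≡s {c} {suc k} () | yes _
  pos≡s {c} {suc k} () | no _

  same-position : ∀ {c c′ k k′} → k ≤ r → k′ ≤ r → pos c k ≡ pos c′ k′ →
                  k ≡ k′ × (k ≡ 0 ⊎ k ≡ r ⊎ c ≡ c′)
  same-position {k = zero} _ _ eq = sym (pos≡s (sym eq)) , inj₁ refl
  same-position {k = suc k} {k′ = zero} _ _ eq = contradiction (pos≡s eq) λ ()
  same-position {c} {c′} {suc k} {suc k′} k≤r k′≤r eq with suc k <? r | suc k′ <? r
  ... | yes k<r | yes k′<r with combine-injective c _ c′ _ (suc-injective (suc-injective eq))
  ...   | c≡c′ , index≡ = trans (sym (toℕ-fromℕ< k<r)) (trans (cong toℕ index≡) (toℕ-fromℕ< k′<r)) , inj₂ (inj₂ c≡c′)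
  same-position {k = suc k} {suc k′} k≤r k′≤r eq | no k≮r | no k′≮r =
    trans (≤∧≮⇒≡ k≤r k≮r) (sym (≤∧≮⇒≡ k′≤r k′≮r)) , inj₂ (inj₁ (≤∧≮⇒≡ k≤r k≮r))
  same-position {k = suc k} {suc k′} k≤r k′≤r eq | yes _ | no _ with () ← suc-injective eq
  same-position {k = suc k} {suc k′} k≤r k′≤r eq | no _ | yes _ with () ← suc-injective eq

  adj-edge : ∀ {c j i u w} → Adj G (edge c j i) u w →
             (u ≡ pos c (toℕ j) × w ≡ pos c (suc (toℕ j))) ⊎ (u ≡ pos c (suc (toℕ j)) × w ≡ pos c (toℕ j))
  adj-edge {c} {j} {i} (inj₁ ends≡) = let p = trans (sym ends≡) (ends-edge c j i) in
    inj₁ (,-injectiveˡ p , ,-injectiveʳ p)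
  adj-edge {c} {j} {i} (inj₂ ends≡) = let p = trans (sym ends≡) (ends-edge c j i) in
    inj₂ (,-injectiveʳ p , ,-injectiveˡ p)

  adj-step : ∀ {c k} (k<r : k < r) i → Adj G (edge c (fromℕ< k<r) i) (pos c k) (pos c (suc k))
  adj-step {c} {k} k<r i =
    inj₁ (subst (λ k′ → Instance.ends G (edge c (fromℕ< k<r) i) ≡ (pos c k′ , pos c (suc k′)))
                (toℕ-fromℕ< k<r) (ends-edge c _ i))

  Passable : Subset q → Fin r → Fin r → Set
  Passable L′ c j = ∃[ i ] lab c j i ∉ L′

  OpenUpTo : Subset q → Fin r → ℕ → Set
  OpenUpTo L′ c k = ∀ j → toℕ j < k → Passable L′ c j

  OpenColumn : Subset q → Fin r → Set
  OpenColumn L′ c = ∀ j → Passable L′ c j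

  open-up-to-0 : ∀ {L′ c} → OpenUpTo L′ c 0
  open-up-to-0 j ()

  ReachedVia : Subset q → Fin r → ℕ → Set
  ReachedVia L′ c k = OpenUpTo L′ c k ⊎ ∃[ c′ ] OpenColumn L′ c′

  reached-via-r : ∀ {L′ c} → ReachedVia L′ c r → ∃[ c′ ] OpenColumn L′ c′
  reached-via-r {c = c} (inj₁ open-c) = c , λ j → open-c j (toℕ<n j)
  reached-via-r (inj₂ open-c′) = open-c′

  -- Reaching position k of column c means that the first k steps of c, or some whole column,
  -- can be passed; it is stated for every name pos c k of the vertex, as s and t have many.
  Invariant : Subset q → Fin (2 + r * r) → Set
  Invariant L′ v = ∀ c k → k ≤ r → v ≡ pos c k → ReachedVia L′ c k

  invariant-at : ∀ {L′ c k} → k ≤ r → ReachedVia L′ c k → Invariant L′ (pos c k)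
  invariant-at {L′} {c} {k} k≤r reached c′ k′ k′≤r pos≡ with same-position k≤r k′≤r pos≡
  ... | refl , inj₁ refl        = inj₁ open-up-to-0
  ... | refl , inj₂ (inj₁ refl) = inj₂ (reached-via-r reached)
  ... | refl , inj₂ (inj₂ refl) = reached

  reach-invariant : ∀ {L′ v} → Reach G L′ v → Invariant L′ v
  reach-invariant here c k _ s≡pos = inj₁ (subst (OpenUpTo _ c) (sym (pos≡s (sym s≡pos))) open-up-to-0)
  reach-invariant {L′} (step e e∉L′ adj ρ) with view e
  ... | ⟨ c , j , i ⟩ with adj-edge adj
  ...   | inj₁ (u≡ , w≡) = subst (Invariant L′) (sym w≡) (invariant-at (toℕ<n j)
          (map₁ extend (reach-invariant ρ c (toℕ j) (<⇒≤ (toℕ<n j)) u≡)))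
    where
    extend : OpenUpTo L′ c (toℕ j) → OpenUpTo L′ c (suc (toℕ j))
    extend open-c j′ j′≤j with toℕ j′ ≟ toℕ j
    ... | yes j′≡j = subst (Passable L′ c) (sym (toℕ-injective j′≡j)) (i , subst (_∉ L′) (label-edge c j i) e∉L′)
    ... | no j′≢j  = open-c j′ (≤∧≢⇒< (s≤s⁻¹ j′≤j) j′≢j)
  ...   | inj₂ (u≡ , w≡) = subst (Invariant L′) (sym w≡) (invariant-at (<⇒≤ (toℕ<n j))
          (map₁ (λ open-c j′ j′<j → open-c j′ (m<n⇒m<1+n j′<j)) (reach-invariant ρ c (suc (toℕ j)) (toℕ<n j) u≡)))

  reach-t⇒open-column : ∀ {L′} → Reach G L′ t → ∃[ c ] OpenColumn L′ c
  reach-t⇒open-column ρ = reached-via-r (reach-invariant ρ zero r ≤-refl (sym (pos-r zero)))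

  reach-along : ∀ {L′ c} → OpenColumn L′ c → ∀ k → k ≤ r → Reach G L′ (pos c k)
  reach-along open-c zero    _   = here
  reach-along {L′} {c} open-c (suc k) k<r =
    step (edge c j i) (subst (_∉ L′) (sym (label-edge c j i)) lab∉L′) (adj-step k<r i)
         (reach-along open-c k (<⇒≤ k<r))
    where
    j i : Fin r
    j = fromℕ< k<r
    i = proj₁ (open-c j)
    lab∉L′ : lab c j i ∉ L′
    lab∉L′ = proj₂ (open-c j)

  open-column⇒reach-t : ∀ {L′ c} → OpenColumn L′ c → Reach G L′ t
  open-column⇒reach-t {L′} {c} open-c = subst (Reach G L′) (pos-r c) (reach-along open-c r ≤-refl)

  Blocking : Subset q → Set
  Blocking L′ = ∀ c → ∃[ j ] ∀ i → lab c j i ∈ L′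

  blocking? : ∀ L′ → Dec (Blocking L′)
  blocking? L′ = all? λ c → any? λ j → all? λ i → lab c j i ∈? L′

  blocking⇒cut : ∀ {L′} → Blocking L′ → IsLabelCut G L′
  blocking⇒cut blocking ρ with reach-t⇒open-column ρ
  ... | c , open-c with blocking c
  ...   | j , blocked with open-c j
  ...     | i , lab∉L′ = lab∉L′ (blocked i)

  cut⇒blocking : ∀ {L′} → IsLabelCut G L′ → Blocking L′
  cut⇒blocking {L′} cut c with ¬∀⟶∃¬ r (Passable L′ c) passable? (λ open-c → cut (open-column⇒reach-t open-c))
    where
    passable? : ∀ j → Dec (Passable L′ c j)
    passable? j = any? λ i → ¬? (lab c j i ∈? L′)
  ... | j , impassable = j , λ i → decidable-stable (lab c j i ∈? L′) (λ lab∉L′ → impassable (i , lab∉L′))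

  cut? : ∀ L′ → Dec (IsLabelCut G L′)
  cut? L′ = map′ blocking⇒cut cut⇒blocking (blocking? L′)

  opt : ∃[ k ] IsOPT G k
  opt = Optimum.opt-exists G cut? (blocking⇒cut {⊤} λ c → zero , λ i → ∈⊤)

  steps-remain : ∀ d k → suc d + k ≡ r → k < r
  steps-remain d k eq = subst (k <_) eq (m<n+m k z<s)

  -- Through the edges of index x; d counts the remaining steps.
  along : ∀ c x k d → d + k ≡ r → Walk G (pos c k) (pos c r)
  along c x k zero    refl = []
  along c x k (suc d) eq   = edge c (fromℕ< (steps-remain d k eq)) x ∷⟨ adj-step (steps-remain d k eq) x ⟩
                             along c x (suc k) d (trans (+-suc d k) eq)

  along-vertices : ∀ c x k d (eq : d + k ≡ r) →
                   All (λ v → ∃[ k′ ] k ≤ k′ × k′ ≤ r × v ≡ pos c k′) (vertices G (along c x k d eq))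
  along-vertices c x k zero    refl = (k , ≤-refl , ≤-refl , refl) ∷ []
  along-vertices c x k (suc d) eq =
    (k , ≤-refl , m+n≤o⇒n≤o (suc d) (≤-reflexive eq) , refl)
    ∷ All.map (λ (k′ , k<k′ , k′≤r , v≡) → k′ , <⇒≤ k<k′ , k′≤r , v≡) (along-vertices c x (suc k) d _)

  along-unique : ∀ c x k d (eq : d + k ≡ r) → Unique (vertices G (along c x k d eq))
  along-unique c x k zero    refl = [] ∷ []
  along-unique c x k (suc d) eq =
    All.map (λ (k′ , k<k′ , k′≤r , v≡) pos≡v →
               <⇒≢ k<k′ (proj₁ (same-position (m+n≤o⇒n≤o (suc d) (≤-reflexive eq)) k′≤r (trans pos≡v v≡))))
            (along-vertices c x (suc k) d _)
    ∷ along-unique c x (suc k) d _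

  along-edges : ∀ c x k d (eq : d + k ≡ r) → All (λ e → ∃[ j ] e ≡ edge c j x) (edges G (along c x k d eq))
  along-edges c x k zero    refl = []
  along-edges c x k (suc d) eq   = (fromℕ< (steps-remain d k eq) , refl) ∷ along-edges c x (suc k) d _

  open Walks G using (vertices-subst; edges-subst)

  opaque
    column-walk : Fin r → Fin r → Walk G s t
    column-walk c x = subst (Walk G s) (pos-r c) (along c x 0 r (+-identityʳ r))

    column-walk-simple : ∀ c x → SimplePath G (column-walk c x)
    column-walk-simple c x = subst Unique (sym (vertices-subst (pos-r c) _)) (along-unique c x 0 r _)

    column-walk-edges : ∀ c x → All (λ e → ∃[ j ] e ≡ edge c j x) (edges G (column-walk c x))
    column-walk-edges c x = subst (All _) (sym (edges-subst (pos-r c) _)) (along-edges c x 0 r _)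

-- Labels are the points of the grid ℤ/r × ℤ/r, and step j of column c is labelled by the line
-- of slope c and offset j: its i-th edge carries the point (i , c i + j).
module Lines (r₀ : ℕ) where

  open import Data.Nat as ℕ using (_+_; _*_; _%_)
  import Data.Nat.Properties as ℕ
  open import Data.Nat.DivMod using (m%n<n)
  open import Data.Nat.Primality using (Prime)
  open import Data.Fin using (zero; toℕ; fromℕ<; combine; remQuot)
  import Data.Fin.Properties as Fin
  open import Data.Fin.Subset using (∣_∣)
  open import Data.Bool using (true; false; if_then_else_)
  open import Data.Product using (_×_; _,_; proj₁; proj₂)
  open import Data.Sum using ([_,_]′)
  open import Data.List.Relation.Unary.All using (lookupAny)
  open import Data.Rational using (ℚ; 0ℚ; 1ℚ)
  import Data.Rational as ℚ
  import Data.Rational.Properties as ℚ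
  open import Relation.Binary.PropositionalEquality
  open import Relation.Nullary using (does; yes; no; contradiction)
  open import Function using (_∘_)
  open Counting using (indicator; count; injective⇒≤count; δ; sum-δ; module BlockCovering)
  open Rationals renaming (sumℚ-mono-≤ to ℚΣ-mono-≤)

  r : ℕ
  r = suc r₀

  opaque
    height : Fin r → Fin r → Fin r → Fin r
    height c j i = fromℕ< (m%n<n (toℕ c * toℕ i + toℕ j) r)

    toℕ-height : ∀ c j i → toℕ (height c j i) ≡ (toℕ c * toℕ i + toℕ j) % r
    toℕ-height c j i = Fin.toℕ-fromℕ< _

  opaque
    lab : Fin r → Fin r → Fin r → Fin (r * r)
    lab c j i = combine i (height c j i)

    abscissa : Fin (r * r) → Fin r
    abscissa ℓ = proj₁ (remQuot r ℓ)

    abscissa-lab : ∀ c j i → abscissa (lab c j i) ≡ i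
    abscissa-lab c j i = cong proj₁ (Fin.remQuot-combine i (height c j i))

    lab-injective : ∀ {c j i c′ j′ i′} → lab c j i ≡ lab c′ j′ i′ → i ≡ i′ × height c j i ≡ height c′ j′ i′
    lab-injective {i = i} {i′ = i′} = Fin.combine-injective i _ i′ _

  open ColumnGraph r₀ (r * r) lab public hiding (r)

  lab-injective-on-column : ∀ c (edge-of-step : Fin r → Fin r) {j j′} →
                            lab c j (edge-of-step j) ≡ lab c j′ (edge-of-step j′) → j ≡ j′
  lab-injective-on-column c edge-of-step {j} {j′} lab≡ with edge-of-step j | lab-injective lab≡
  ... | i | refl , height≡ = Fin.toℕ-injective
    (%-+-cancelˡ (toℕ c * toℕ i) (trans (sym (toℕ-height c j i)) (trans (cong toℕ height≡) (toℕ-height c j′ i)))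
                 (Fin.toℕ<n j) (Fin.toℕ<n j′))
    where open Residues using (%-+-cancelˡ)

  instance
    fromℕ-r-positive : ℚ.Positive (fromℕ r)
    fromℕ-r-positive = ℚ.positive (fromℕ-pos r₀)

  r⁻¹ : ℚ
  r⁻¹ = (ℚ.1/ fromℕ r) {{ℚ.pos⇒nonZero (fromℕ r)}}

  r*r⁻¹≡1 : fromℕ r ℚ.* r⁻¹ ≡ 1ℚ
  r*r⁻¹≡1 = ℚ.*-inverseʳ (fromℕ r) {{ℚ.pos⇒nonZero (fromℕ r)}}

  instance
    r⁻¹-nonNegative : ℚ.NonNegative r⁻¹
    r⁻¹-nonNegative = ℚ.pos⇒nonNeg r⁻¹ {{ℚ.1/pos⇒pos (fromℕ r)}}

  x⋆ : Fin (r * r) → ℚ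
  x⋆ _ = r⁻¹

  open Walks G using (walk-reach; labels∉unused; ∉unused⇒occurs; occurs⇒any)
  open ℚΣ using (sum-syntax; sum-cong-≗; ∑-comm)

  lp-value : lpValue G x⋆ ≡ fromℕ r
  lp-value = begin
    sumℚ G x⋆                               ≡⟨ sumℚ≡sum G x⋆ ⟩
    ℚΣ.sum x⋆                               ≡⟨ sumℚ-const (r * r) r⁻¹ ⟩
    fromℕ (r * r) ℚ.* r⁻¹                   ≡⟨ cong (ℚ._* r⁻¹) (fromℕ-* r r) ⟩
    fromℕ r ℚ.* fromℕ r ℚ.* r⁻¹             ≡⟨ ℚ.*-assoc (fromℕ r) (fromℕ r) r⁻¹ ⟩
    fromℕ r ℚ.* (fromℕ r ℚ.* r⁻¹)           ≡⟨ cong (fromℕ r ℚ.*_) r*r⁻¹≡1 ⟩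
    fromℕ r ℚ.* 1ℚ                          ≡⟨ ℚ.*-identityʳ (fromℕ r) ⟩
    fromℕ r                                 ∎
    where open ≡-Reasoning

  -- Any s–t walk runs through a whole column, whose steps carry pairwise distinct labels.
  walk-uses-r-labels : (w : Walk G s t) → r ℕ.≤ count (occurs G w)
  walk-uses-r-labels w with reach-t⇒open-column (walk-reach here w (labels∉unused w))
  ... | c , open-c = injective⇒≤count (occurs G w) (λ j → lab c j (proj₁ (open-c j)))
                       (lab-injective-on-column c (λ j → proj₁ (open-c j)))
                       (λ j → ∉unused⇒occurs w (proj₂ (open-c j)))

  lp-feasible : LP2Feasible G x⋆
  lp-feasible = (λ _ → ℚ.nonNegative⁻¹ r⁻¹) , λ w _ → begin
    1ℚ                                                  ≡⟨ r*r⁻¹≡1 ⟨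
    fromℕ r ℚ.* r⁻¹                                     ≤⟨ ℚ.*-monoʳ-≤-nonNeg r⁻¹
                                                             (fromℕ-mono-≤ (walk-uses-r-labels w)) ⟩
    fromℕ (count (occurs G w)) ℚ.* r⁻¹                  ≡⟨ sumℚ-fromℕ-* (indicator ∘ occurs G w) r⁻¹ ⟨
    ∑[ ℓ < r * r ] (fromℕ (indicator (occurs G w ℓ)) ℚ.* r⁻¹)
                                                        ≡⟨ sum-cong-≗ (λ ℓ → if-then-0≡ (occurs G w ℓ) r⁻¹) ⟨
    ∑[ ℓ < r * r ] (if occurs G w ℓ then r⁻¹ else 0ℚ)   ≡⟨ sumℚ≡sum G (λ ℓ → if occurs G w ℓ then r⁻¹ else 0ℚ) ⟨
    sumℚ G (λ ℓ → if occurs G w ℓ then r⁻¹ else 0ℚ)     ∎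
    where open ℚ.≤-Reasoning

  column-walk-abscissa : ∀ x {ℓ} → occurs G (column-walk zero x) ℓ ≡ true → abscissa ℓ ≡ x
  column-walk-abscissa x {ℓ} occurs≡
    with lookupAny (column-walk-edges zero x) (occurs⇒any (column-walk zero x) occurs≡)
  ... | (j , e≡edge) , label≡ℓ = begin
    abscissa ℓ                           ≡⟨ cong abscissa (trans (sym label≡ℓ) (cong (Instance.label G) e≡edge)) ⟩
    abscissa (Instance.label G (edge zero j x)) ≡⟨ cong abscissa (label-edge zero j x) ⟩
    abscissa (lab zero j x)              ≡⟨ abscissa-lab zero j x ⟩
    x                                    ∎
    where open ≡-Reasoning

  -- The walks along column 0 through the edges of index x are simple and have disjoint label
  -- sets (the labels of abscissa x), so any feasible solution has weight at least r.
  lp-lower-bound : ∀ y → LP2Feasible G y → fromℕ r ℚ.≤ lpValue G y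
  lp-lower-bound y (y≥0 , y-feasible) = begin
    fromℕ r                                                   ≡⟨ ℚ.*-identityʳ (fromℕ r) ⟨
    fromℕ r ℚ.* 1ℚ                                            ≡⟨ sumℚ-const r 1ℚ ⟨
    ∑[ x < r ] 1ℚ                                             ≤⟨ ℚΣ-mono-≤ column-feasible ⟩
    ∑[ x < r ] ∑[ ℓ < r * r ] on-column x ℓ                   ≤⟨ ℚΣ-mono-≤ (λ x → ℚΣ-mono-≤ (restrict x)) ⟩
    ∑[ x < r ] ∑[ ℓ < r * r ] (fromℕ (δ x (abscissa ℓ)) ℚ.* y ℓ)
                                         ≡⟨ ∑-comm (λ x ℓ → fromℕ (δ x (abscissa ℓ)) ℚ.* y ℓ) ⟩
    ∑[ ℓ < r * r ] ∑[ x < r ] (fromℕ (δ x (abscissa ℓ)) ℚ.* y ℓ)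
                                         ≡⟨ sum-cong-≗ (λ ℓ → sumℚ-fromℕ-* (λ x → δ x (abscissa ℓ)) (y ℓ)) ⟩
    ∑[ ℓ < r * r ] (fromℕ (Counting.sum (λ x → δ x (abscissa ℓ))) ℚ.* y ℓ)
                                         ≡⟨ sum-cong-≗ (λ ℓ → cong (λ n → fromℕ n ℚ.* y ℓ) (sum-δ (abscissa ℓ))) ⟩
    ∑[ ℓ < r * r ] (1ℚ ℚ.* y ℓ)                               ≡⟨ sum-cong-≗ (λ ℓ → ℚ.*-identityˡ (y ℓ)) ⟩
    ℚΣ.sum y                                                  ≡⟨ sumℚ≡sum G y ⟨
    lpValue G y                                               ∎
    where
    open ℚ.≤-Reasoning
    on-column : Fin r → Fin (r * r) → ℚ
    on-column x ℓ = if occurs G (column-walk zero x) ℓ then y ℓ else 0ℚ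
    column-feasible : ∀ x → 1ℚ ℚ.≤ ∑[ ℓ < r * r ] on-column x ℓ
    column-feasible x = ℚ.≤-trans (y-feasible (column-walk zero x) (column-walk-simple zero x))
                                  (ℚ.≤-reflexive (sumℚ≡sum G (on-column x)))
    on-abscissa : ∀ x ℓ → (if occurs G (column-walk zero x) ℓ then y ℓ else 0ℚ)
                         ℚ.≤ (if does (x Fin.≟ abscissa ℓ) then y ℓ else 0ℚ)
    on-abscissa x ℓ with occurs G (column-walk zero x) ℓ in occurs≡ | x Fin.≟ abscissa ℓ
    ... | true  | yes _  = ℚ.≤-refl
    ... | true  | no x≢ℓ = contradiction (sym (column-walk-abscissa x occurs≡)) x≢ℓ
    ... | false | yes _  = y≥0 ℓ
    ... | false | no _   = ℚ.≤-refl
    restrict : ∀ x ℓ → on-column x ℓ ℚ.≤ fromℕ (δ x (abscissa ℓ)) ℚ.* y ℓ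
    restrict x ℓ = ℚ.≤-trans (on-abscissa x ℓ) (ℚ.≤-reflexive (if-then-0≡ (does (x Fin.≟ abscissa ℓ)) (y ℓ)))

  lp-optimal : LP2Optimal G x⋆
  lp-optimal = lp-feasible , λ y y-feasible → ℚ.≤-trans (ℚ.≤-reflexive lp-value) (lp-lower-bound y y-feasible)

  module _ (prime-r : Prime r) where

    open Residues using (lines-meet-once)

    heights≡ : ∀ {c c′ j j′ x} → height c j x ≡ height c′ j′ x →
               (toℕ c * toℕ x + toℕ j) % r ≡ (toℕ c′ * toℕ x + toℕ j′) % r
    heights≡ {c} {c′} {j} {j′} {x} h = trans (sym (toℕ-height c j x)) (trans (cong toℕ h) (toℕ-height c′ j′ x))

    -- A blocking set contains, for every slope, a whole line; distinct lines meet at most once.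
    blocking-size : ∀ {L} → Blocking L → r * r ℕ.≤ 2 * ∣ L ∣
    blocking-size {L} blocking =
      ℕ.+-cancelʳ-≤ (r * r) (r * r) (2 * ∣ L ∣)
        (subst (ℕ._≤ 2 * ∣ L ∣ + r * r) (cong (r * r +_) (ℕ.+-identityʳ (r * r)))
               (BlockCovering.cover-size point injective-in-column lines-meet L (λ c → proj₂ (blocking c))))
      where
      point : Fin r → Fin r → Fin (r * r)
      point c = lab c (proj₁ (blocking c))
      injective-in-column : ∀ c {x y} → point c x ≡ point c y → x ≡ y
      injective-in-column c eq = proj₁ (lab-injective eq)
      lines-meet : ∀ {c c′} → c ≢ c′ → ∀ {x x′ y y′} → point c x ≡ point c′ x′ → point c y ≡ point c′ y′ → x ≡ y
      lines-meet {c} {c′} c≢c′ {x} {x′} {y} {y′} at-x at-y with lab-injective at-x | lab-injective at-y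
      ... | refl , height-x | refl , height-y =
        [ (λ c≡c′ → contradiction (Fin.toℕ-injective c≡c′) c≢c′) , Fin.toℕ-injective ]′
          (lines-meet-once prime-r (heights≡ height-x) (heights≡ height-y)
                           (Fin.toℕ<n c) (Fin.toℕ<n c′) (Fin.toℕ<n x) (Fin.toℕ<n y))

    opt-lower-bound : ∀ {k} → IsOPT G k → r * r ℕ.≤ 2 * k
    opt-lower-bound ((L , L-cut , ∣L∣≡k) , _) =
      subst (λ n → r * r ℕ.≤ 2 * n) ∣L∣≡k (blocking-size (cut⇒blocking L-cut))

module Exponents where

  open import Data.Nat
  open import Data.Nat.Properties
  open import Data.Nat.Solver using (module +-*-Solver)
  open import Data.Rational using (1ℚ)
  import Data.Rational as ℚ
  import Data.Rational.Properties as ℚ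
  open import Relation.Binary.PropositionalEquality
  open Rationals using (fromℕ-*; fromℕ-^; fromℕ-mono-≤)
  open +-*-Solver

  ^-distribʳ-* : ∀ m n o → (m * n) ^ o ≡ m ^ o * n ^ o
  ^-distribʳ-* m n zero    = refl
  ^-distribʳ-* m n (suc o) = trans (cong (m * n *_) (^-distribʳ-* m n o))
    (solve 4 (λ m n x y → m :* n :* (x :* y) := m :* x :* (n :* y)) refl m n (m ^ o) (n ^ o))

  cube : ∀ n → n * (n * n) ≡ n ^ 3
  cube n = solve 1 (λ n → n :* (n :* n) := n :* (n :* (n :* con 1))) refl n

  -- The factor 2 in r² ≤ 2k is absorbed by 2^b ≤ r.
  ratio-bound-ℕ : ∀ {r k} a b → 1 ≤ a → 2 ^ b ≤ r → r * r ≤ 2 * k →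
                  r ^ (3 * b) * (r * (r * r)) ^ b ≤ k ^ (3 * b) * (r * (r * r)) ^ (3 * a)
  ratio-bound-ℕ {r} {k} a b 1≤a 2^b≤r r*r≤2k = begin
    r ^ (3 * b) * (r * (r * r)) ^ b      ≡⟨ cong (λ n → r ^ (3 * b) * n ^ b) (cube r) ⟩
    r ^ (3 * b) * (r ^ 3) ^ b            ≡⟨ cong (r ^ (3 * b) *_) (^-*-assoc r 3 b) ⟩
    r ^ (3 * b) * r ^ (3 * b)            ≡⟨ ^-distribʳ-* r r (3 * b) ⟨
    (r * r) ^ (3 * b)                    ≤⟨ ^-monoˡ-≤ (3 * b) r*r≤2k ⟩
    (2 * k) ^ (3 * b)                    ≡⟨ ^-distribʳ-* 2 k (3 * b) ⟩
    2 ^ (3 * b) * k ^ (3 * b)            ≤⟨ *-monoˡ-≤ (k ^ (3 * b)) 2^3b≤m ⟩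
    m * k ^ (3 * b)                      ≤⟨ *-monoˡ-≤ (k ^ (3 * b)) m≤m^3a ⟩
    m ^ (3 * a) * k ^ (3 * b)            ≡⟨ *-comm (m ^ (3 * a)) (k ^ (3 * b)) ⟩
    k ^ (3 * b) * m ^ (3 * a)            ∎
    where
    open ≤-Reasoning
    m : ℕ
    m = r * (r * r)
    2^3b≤m : 2 ^ (3 * b) ≤ m
    2^3b≤m = begin
      2 ^ (3 * b)    ≡⟨ cong (2 ^_) (*-comm 3 b) ⟩
      2 ^ (b * 3)    ≡⟨ ^-*-assoc 2 b 3 ⟨
      (2 ^ b) ^ 3    ≤⟨ ^-monoˡ-≤ 3 2^b≤r ⟩
      r ^ 3          ≡⟨ cube r ⟨
      m              ∎
    1≤m : 1 ≤ m
    1≤m = ≤-trans (^-monoʳ-≤ 2 (z≤n {3 * b})) 2^3b≤m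
    m≤m^3a : m ≤ m ^ (3 * a)
    m≤m^3a = begin
      m              ≡⟨ *-identityʳ m ⟨
      m ^ 1          ≤⟨ ^-monoʳ-≤ m {{>-nonZero 1≤m}} (≤-trans 1≤a (m≤m+n a _)) ⟩
      m ^ (3 * a)    ∎

  ratio-bound : ∀ {r k} a b → 1 ≤ a → 2 ^ b ≤ r → r * r ≤ 2 * k →
                RatioBound k (fromℕ r) 1ℚ (r * (r * r)) a b
  ratio-bound {r} {k} a b 1≤a 2^b≤r r*r≤2k = begin
    (1ℚ ℚ.* fromℕ r) ^ℚ (3 * b) ℚ.* fromℕ m ^ℚ b
      ≡⟨ cong (λ v → v ^ℚ (3 * b) ℚ.* fromℕ m ^ℚ b) (ℚ.*-identityˡ (fromℕ r)) ⟩
    fromℕ r ^ℚ (3 * b) ℚ.* fromℕ m ^ℚ b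
      ≡⟨ fromℕ-^-* r (3 * b) m b ⟨
    fromℕ (r ^ (3 * b) * m ^ b)
      ≤⟨ fromℕ-mono-≤ (ratio-bound-ℕ a b 1≤a 2^b≤r r*r≤2k) ⟩
    fromℕ (k ^ (3 * b) * m ^ (3 * a))
      ≡⟨ fromℕ-^-* k (3 * b) m (3 * a) ⟩
    fromℕ k ^ℚ (3 * b) ℚ.* fromℕ m ^ℚ (3 * a) ∎
    where
    open ℚ.≤-Reasoning
    m : ℕ
    m = r * (r * r)
    fromℕ-^-* : ∀ x e y f → fromℕ (x ^ e * y ^ f) ≡ fromℕ x ^ℚ e ℚ.* fromℕ y ^ℚ f
    fromℕ-^-* x e y f = trans (fromℕ-* (x ^ e) (y ^ f)) (cong₂ ℚ._*_ (fromℕ-^ x e) (fromℕ-^ y f))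

open import Data.Nat using (ℕ; _≤_; suc)
open import Data.Product using (Σ; _×_; ∃)
open import Data.Fin using (Fin)
open import Data.Rational using (ℚ; _<_; 0ℚ)
open import Data.Nat using (_+_; _*_; _^_; s≤s; z≤n)
open import Data.Nat.Properties using (≤-trans; <⇒≤; m≤m+n; m≤n+m; m≤m*n)
open import Data.Product using (_,_; proj₁; proj₂)
open import Data.Rational using (1ℚ)
open import Relation.Binary.PropositionalEquality using (subst; sym)
open Primes using (∃-prime>)
open Rationals using (fromℕ-pos)
open Exponents using (ratio-bound)

theorem1 : (a b : ℕ) → 1 ≤ a → 1 ≤ b →
    Σ ℚ λ C → (0ℚ < C) ×
      ((M : ℕ) → Σ ℕ λ m → (M ≤ m) × (1 ≤ m) ×
        Σ (Instance m) λ I →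
          Σ ℕ λ k → IsOPT I k ×
          Σ (Fin (Instance.q I) → ℚ) λ x → LP2Optimal I x ×
            (0ℚ < lpValue I x) × RatioBound k (lpValue I x) C m a b)
theorem1 a b 1≤a _ = 1ℚ , fromℕ-pos 0 , instance-beyond
  where
  instance-beyond : (M : ℕ) → Σ ℕ λ m → (M ≤ m) × (1 ≤ m) ×
    Σ (Instance m) λ I → Σ ℕ λ k → IsOPT I k ×
    Σ (Fin (Instance.q I) → ℚ) λ x → LP2Optimal I x × (0ℚ < lpValue I x) × RatioBound k (lpValue I x) 1ℚ m a b
  instance-beyond M with ∃-prime> (M + 2 ^ b)
  ... | suc r₀ , prime-r , M+2^b<r =
    r * (r * r) , ≤-trans (m≤m+n M _) M+2^b≤m , ≤-trans (s≤s z≤n) (m≤m*n r (r * r)) ,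
    G , k , k-opt , x⋆ , lp-optimal , subst (0ℚ <_) (sym lp-value) (fromℕ-pos r₀) ,
    subst (λ v → RatioBound k v 1ℚ (r * (r * r)) a b) (sym lp-value)
          (ratio-bound {r} {k} a b 1≤a (≤-trans (m≤n+m _ M) (<⇒≤ M+2^b<r)) (opt-lower-bound prime-r k-opt))
    where
    open Lines r₀
    k : ℕ
    k = proj₁ opt
    k-opt : IsOPT G k
    k-opt = proj₂ opt
    M+2^b≤m : M + 2 ^ b ≤ r * (r * r)
    M+2^b≤m = ≤-trans (<⇒≤ M+2^b<r) (m≤m*n r (r * r))
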